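{- There exists a deterministic procedure which, given access to the independent set oracle of a simple undirected graph $G$ on $n$ vertices and given two disjoint vertex sets $A$ and $B$ that are each independent sets of $G$, enumerates all edges of $G$ with one endpoint in $A$ and the other in $B$, such that for every $i$ the $i$-th edge is reported after at most $O(1+i\log n)$ independent set queries, and the procedure terminates after $O(1+X\log n)$ independent set queries, where $X$ is the total number of edges between $A$ and $B$.
   Context: Independent set oracle: given a vertex set $U$, it returns $1$ if no edge of $G$ has both endpoints in $U$, and $0$ otherwise. The constants in $O(\cdot)$ are absolute. -}

module Defs where

open import Data.Nat using (ℕ; zero; suc; _+_; _*_; _≤_)
open import Data.Nat.Logarithm using (⌊log₂_⌋)
open import Data.Bool using (Bool; true; false; _∧_; not; if_then_else_)
open import Data.Fin using (Fin)
open import Data.Fin.Subset using (Subset; _∈_; Empty)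
open import Data.Vec using (lookup)
open import Data.List using (List; []; _∷_; length; map)
open import Data.Product using (_×_; _,_; proj₁; proj₂; Σ; ∃)
open import Relation.Binary.PropositionalEquality using (_≡_)
open import Relation.Nullary using (¬_)
open import Data.Empty using (⊥)
import Data.Fin

allF : ∀ {n} → (Fin n → Bool) → Bool
allF {zero}  f = true
allF {suc n} f = f Data.Fin.zero ∧ allF (λ i → f (Data.Fin.suc i))

countF : ∀ {n} → (Fin n → Bool) → ℕ
countF {zero}  f = 0
countF {suc n} f = (if f Data.Fin.zero then 1 else 0) + countF (λ i → f (Data.Fin.suc i))

sumF : ∀ {n} → (Fin n → ℕ) → ℕ
sumF {zero}  f = 0
sumF {suc n} f = f Data.Fin.zero + sumF (λ i → f (Data.Fin.suc i))

record Graph (n : ℕ) : Set where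
  field
    adj    : Fin n → Fin n → Bool
    sym    : ∀ u v → adj u v ≡ adj v u
    irrefl : ∀ u → adj u u ≡ false
open Graph public

Edge : ∀ {n} → Graph n → Fin n → Fin n → Set
Edge G u v = adj G u v ≡ true

Independent : ∀ {n} → Graph n → Subset n → Set
Independent G U = ∀ u v → u ∈ U → v ∈ U → ¬ Edge G u v

Disjoint : ∀ {n} → Subset n → Subset n → Set
Disjoint A B = ∀ u → u ∈ A → u ∈ B → ⊥

indepOracle : ∀ {n} → Graph n → Subset n → Bool
indepOracle G U =
  allF (λ u → allF (λ v → not (lookup U u ∧ lookup U v ∧ adj G u v)))

-- Number of edges of G with one endpoint in A and the other in B
-- (A, B disjoint, so each such edge is counted once as a pair (a , b)).
crossEdges : ∀ {n} → Graph n → Subset n → Subset n → ℕ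
crossEdges G A B =
  sumF (λ a → countF (λ b → lookup A a ∧ lookup B b ∧ adj G a b))

-- A deterministic oracle procedure on vertex set Fin n: a (well-founded)
-- decision tree that may ask independent-set queries, report edges
-- (as pairs of vertices), and stop.
data Proc (n : ℕ) : Set where
  done   : Proc n
  query  : Subset n → (Bool → Proc n) → Proc n
  report : Fin n × Fin n → Proc n → Proc n

-- Running a procedure against an oracle, with k queries made so far.
-- Result: list of (reported edge , number of queries made before it was
-- reported), and the total number of queries until termination.
exec : ∀ {n} → Proc n → (Subset n → Bool) → ℕ →
       List ((Fin n × Fin n) × ℕ) × ℕ
exec done         o k = [] , k
exec (query U f)  o k = exec (f (o U)) o (suc k)
exec (report e p) o k with exec p o k
... | l , t = (e , k) ∷ l , t

run : ∀ {n} → Proc n → Graph n → List ((Fin n × Fin n) × ℕ) × ℕ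
run p G = exec p (indepOracle G) 0

-- Put the vertices into a balanced binary tree of depth ⌊log₂ n⌋ + 1. To list the edges from the A-vertices
-- of a subtree S to the B-vertices of a subtree T, ask whether (A ∩ S) ∪ (B ∩ T) is independent; as A and B
-- are independent, this fails exactly when such an edge exists. On failure split S (or T, once S is a leaf)
-- and recurse on both halves; two leaves give the edge itself. Every failing query has an edge below it, so
-- the two queries spent per level of S and T can be charged to the next edge reported: the i-th edge comes
-- after at most 1 + 4i(⌊log₂ n⌋ + 1) queries, and the run ends after 1 + 4X(⌊log₂ n⌋ + 1).

module Submission where

open import Defs
open import Data.Nat using (ℕ; zero; suc; _+_; _*_; _^_; _≤_; _<_; z≤n; s≤s)
open import Data.Nat.Properties
open import Data.Nat.Tactic.RingSolver using (solve-∀)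
open import Data.Nat.Logarithm using (⌊log₂_⌋; ⌊log₂⌋-mono-≤; ⌊log₂[2^n]⌋≡n)
open import Data.Bool using (Bool; true; false; _∧_; _∨_; not; if_then_else_)
open import Data.Bool.Properties using (not-injective)
open import Data.Fin using (Fin; zero; suc; toℕ)
open import Data.Fin.Properties using (toℕ<n)
open import Data.Fin.Subset using (Subset; _∈_; _∩_; _∪_; ⁅_⁆) renaming (⊥ to ∅)
open import Data.Fin.Subset.Properties
  using (∉⊥; x∈⁅x⁆; x∈⁅y⁆⇒x≡y; ⊆-antisym; p∩q⊆p; p∩q⊆q; x∈p∩q⁺; p⊆p∪q; q⊆p∪q; x∈p∪q⁻; ∩-distribˡ-∪)
import Data.Vec as Vec
open import Data.Vec.Properties using (lookup⇒[]=; []=⇒lookup; lookup-zipWith)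
open import Data.List using (List; []; _∷_; _++_; length; map; lookup; take; drop; allFin)
open import Data.List.Properties
  using (length-++; length-map; map-++; length-take; length-drop; take++drop≡id; length-tabulate)
open import Data.List.Membership.Propositional using () renaming (_∈_ to _∈ₗ_)
open import Data.List.Membership.Propositional.Properties using (∈-++⁺ˡ; ∈-++⁺ʳ; ∈-++⁻; ∈-allFin)
open import Data.List.Relation.Unary.Any using (here; there)
open import Data.List.Relation.Unary.All as All using (All; []; _∷_)
open import Data.List.Relation.Unary.All.Properties as All using ()
open import Data.List.Relation.Unary.AllPairs using ([]; _∷_)
open import Data.List.Relation.Unary.Unique.Propositional using (Unique)
open import Data.List.Relation.Unary.Unique.Propositional.Properties as Unique using ()
open import Data.Product using (Σ; _×_; _,_; proj₁; proj₂; ∃)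
open import Data.Sum as Sum using (inj₁; inj₂; [_,_])
open import Data.Unit using (⊤; tt)
open import Data.Empty using (⊥; ⊥-elim)
open import Function using (id; _∘_)
open import Level using (0ℓ)
open import Relation.Binary.PropositionalEquality as ≡
  using (_≡_; refl; trans; cong; cong₂; subst; subst₂; module ≡-Reasoning)
import Relation.Unary as U
open import Algebra.Properties.CommutativeSemigroup +-commutativeSemigroup using (interchange)

sumF-cong : ∀ {m} {f g : Fin m → ℕ} → (∀ i → f i ≡ g i) → sumF f ≡ sumF g
sumF-cong {zero}  f≗g = refl
sumF-cong {suc m} f≗g = cong₂ _+_ (f≗g zero) (sumF-cong (f≗g ∘ suc))

sumF-+ : ∀ {m} (f g : Fin m → ℕ) → sumF (λ i → f i + g i) ≡ sumF f + sumF g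
sumF-+ {zero}  f g = refl
sumF-+ {suc m} f g = begin
  (f zero + g zero) + sumF (λ i → f (suc i) + g (suc i))
    ≡⟨ cong (f zero + g zero +_) (sumF-+ (f ∘ suc) (g ∘ suc)) ⟩
  (f zero + g zero) + (sumF (f ∘ suc) + sumF (g ∘ suc))
    ≡⟨ interchange (f zero) (g zero) _ _ ⟩
  (f zero + sumF (f ∘ suc)) + (g zero + sumF (g ∘ suc)) ∎
  where open ≡-Reasoning

term≤sumF : ∀ {m} (f : Fin m → ℕ) i → f i ≤ sumF f
term≤sumF f zero    = m≤m+n (f zero) _
term≤sumF f (suc i) = ≤-trans (term≤sumF (f ∘ suc) i) (m≤n+m _ (f zero))

indicator : Bool → ℕ
indicator b = if b then 1 else 0

countF≡sumF : ∀ {m} (f : Fin m → Bool) → countF f ≡ sumF (indicator ∘ f)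
countF≡sumF {zero}  f = refl
countF≡sumF {suc m} f = cong (indicator (f zero) +_) (countF≡sumF (f ∘ suc))

countF-+ : ∀ {m} (f g h : Fin m → Bool) →
           (∀ i → indicator (h i) ≡ indicator (f i) + indicator (g i)) →
           countF h ≡ countF f + countF g
countF-+ f g h split = begin
  countF h                                          ≡⟨ countF≡sumF h ⟩
  sumF (indicator ∘ h)                              ≡⟨ sumF-cong split ⟩
  sumF (λ i → indicator (f i) + indicator (g i))    ≡⟨ sumF-+ (indicator ∘ f) (indicator ∘ g) ⟩
  sumF (indicator ∘ f) + sumF (indicator ∘ g)       ≡⟨ ≡.sym (cong₂ _+_ (countF≡sumF f) (countF≡sumF g)) ⟩
  countF f + countF g                               ∎
  where open ≡-Reasoning

indicator-∨ : ∀ w {x y} z → (x ≡ true → y ≡ true → ⊥) →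
              indicator (w ∧ (x ∨ y) ∧ z) ≡ indicator (w ∧ x ∧ z) + indicator (w ∧ y ∧ z)
indicator-∨ false z _ = refl
indicator-∨ true {true}  {true}  z x∧y = ⊥-elim (x∧y refl refl)
indicator-∨ true {true}  {false} z _   = ≡.sym (+-identityʳ _)
indicator-∨ true {false} {y}     z _   = refl

allF-false⁻ : ∀ {m} (f : Fin m → Bool) → allF f ≡ false → ∃ λ i → f i ≡ false
allF-false⁻ {suc m} f allF≡false with f zero in f₀
... | false = zero , f₀
... | true  = let i , fi = allF-false⁻ (f ∘ suc) allF≡false in suc i , fi

allF-false⁺ : ∀ {m} (f : Fin m → Bool) i → f i ≡ false → allF f ≡ false
allF-false⁺ f zero    fi rewrite fi = refl
allF-false⁺ f (suc i) fi with f zero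
... | true  = allF-false⁺ (f ∘ suc) i fi
... | false = refl

module _ {X : Set} where

  Transcript : Set
  Transcript = List (X × ℕ) × ℕ

  _⊕_ : Transcript → Transcript → Transcript
  r₁ ⊕ r₂ = proj₁ r₁ ++ proj₁ r₂ , proj₂ r₂

  OnSchedule : ℕ → ℕ → List (X × ℕ) → Set
  OnSchedule b s []       = ⊤
  OnSchedule b s (x ∷ xs) = proj₂ x ≤ b + s × OnSchedule (b + s) s xs

  Paced : ℕ → ℕ → Transcript → Set
  Paced b s r = OnSchedule b s (proj₁ r) × proj₂ r ≤ b + length (proj₁ r) * s

  onSchedule-lookup : ∀ {b s} xs → OnSchedule b s xs →
                      ∀ i → proj₂ (lookup xs i) ≤ b + suc (toℕ i) * s
  onSchedule-lookup {b} {s} (x ∷ xs) (x≤ , xs≤) zero =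
    ≤-trans x≤ (≤-reflexive (cong (b +_) (≡.sym (+-identityʳ s))))
  onSchedule-lookup {b} {s} (x ∷ xs) (x≤ , xs≤) (suc i) =
    ≤-trans (onSchedule-lookup xs xs≤ i) (≤-reflexive (+-assoc b s _))

  onSchedule-weaken : ∀ {b s b′ s′} xs → b + s ≤ b′ + s′ → s ≤ s′ →
                      OnSchedule b s xs → OnSchedule b′ s′ xs
  onSchedule-weaken []       _   _   _           = tt
  onSchedule-weaken (x ∷ xs) b≤ s≤ (x≤ , xs≤) =
    ≤-trans x≤ b≤ , onSchedule-weaken xs (+-mono-≤ b≤ s≤) s≤ xs≤

  onSchedule-++ : ∀ {b s} xs {ys} → OnSchedule b s xs →
                  OnSchedule (b + length xs * s) s ys → OnSchedule b s (xs ++ ys)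
  onSchedule-++ {b} {s} [] {ys} _ ys≤ = subst (λ c → OnSchedule c s ys) (+-identityʳ b) ys≤
  onSchedule-++ {b} {s} (x ∷ xs) {ys} (x≤ , xs≤) ys≤ =
    x≤ , onSchedule-++ xs xs≤ (subst (λ c → OnSchedule c s ys) (≡.sym (+-assoc b s _)) ys≤)

  paced-[] : ∀ {b s} → Paced b s ([] , b)
  paced-[] {b} = tt , m≤m+n b 0

  paced-[_] : ∀ x {b s} → Paced b s ((x , b) ∷ [] , b)
  paced-[ x ] {b} = (m≤m+n b _ , tt) , m≤m+n b _

  -- The query before each half is charged to the (at least one) report, raising the pace by 2.
  paced-⊕ : ∀ {b s} (r₁ r₂ : Transcript) → 1 ≤ length (proj₁ r₁) + length (proj₁ r₂) →
            Paced (suc b) s r₁ → Paced (suc (proj₂ r₁)) s r₂ → Paced b (2 + s) (r₁ ⊕ r₂)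
  paced-⊕ {b} {s} (L₁ , t₁) (L₂ , t₂) nonempty (L₁≤ , t₁≤) (L₂≤ , t₂≤) =
    onSchedule-++ L₁ (onSchedule-weaken L₁ first (m≤n+m s 2) L₁≤)
                     (onSchedule-weaken L₂ second (m≤n+m s 2) L₂≤) ,
    total
    where
    first : suc b + s ≤ b + (2 + s)
    first = ≤-trans (m≤m+n _ 1) (≤-reflexive (eq b s))
      where eq : ∀ b s → suc b + s + 1 ≡ b + (2 + s)
            eq = solve-∀
    second : suc t₁ + s ≤ b + length L₁ * (2 + s) + (2 + s)
    second = begin
      suc t₁ + s                                   ≤⟨ +-monoˡ-≤ s (s≤s t₁≤) ⟩
      2 + b + length L₁ * s + s                    ≤⟨ m≤m+n _ (2 * length L₁) ⟩
      2 + b + length L₁ * s + s + 2 * length L₁    ≡⟨ eq b s (length L₁) ⟩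
      b + length L₁ * (2 + s) + (2 + s)            ∎
      where open ≤-Reasoning
            eq : ∀ b s l → 2 + b + l * s + s + 2 * l ≡ b + l * (2 + s) + (2 + s)
            eq = solve-∀
    total : t₂ ≤ b + length (L₁ ++ L₂) * (2 + s)
    total = begin
      t₂                                          ≤⟨ t₂≤ ⟩
      suc t₁ + length L₂ * s                      ≤⟨ +-monoˡ-≤ _ (s≤s t₁≤) ⟩
      2 + b + length L₁ * s + length L₂ * s       ≡⟨ +-assoc (2 + b) _ _ ⟩
      2 + b + (length L₁ * s + length L₂ * s)     ≡⟨ cong (2 + b +_) (≡.sym (*-distribʳ-+ s (length L₁) _)) ⟩
      2 + b + (length L₁ + length L₂) * s         ≤⟨ 2+b+m*s≤b+m*[2+s] nonempty ⟩
      b + (length L₁ + length L₂) * (2 + s)       ≡⟨ cong (λ m → b + m * (2 + s)) (≡.sym (length-++ L₁)) ⟩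
      b + length (L₁ ++ L₂) * (2 + s)             ∎
      where open ≤-Reasoning
            2+b+m*s≤b+m*[2+s] : ∀ {m} → 1 ≤ m → 2 + b + m * s ≤ b + m * (2 + s)
            2+b+m*s≤b+m*[2+s] {suc k} _ = ≤-trans (m≤m+n _ (2 * k)) (≤-reflexive (eq b s k))
              where eq : ∀ b s k → 2 + b + suc k * s + 2 * k ≡ b + suc k * (2 + s)
                    eq = solve-∀

module _ {A : Set} where

  record Enumerates (P : U.Pred A 0ℓ) (xs : List A) : Set where
    field
      sound    : All P xs
      complete : P U.⊆ (_∈ₗ xs)
      unique   : Unique xs

  enumerates-[] : ∀ {P} → U.Empty P → Enumerates P []
  enumerates-[] empty = record
    { sound = [] ; complete = λ {x} Px → ⊥-elim (empty x Px) ; unique = [] }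

  enumerates-[_] : ∀ {P} x → P x → (∀ {y} → P y → y ≡ x) → Enumerates P (x ∷ [])
  enumerates-[ x ] Px only = record
    { sound = Px ∷ [] ; complete = λ Py → here (only Py) ; unique = [] ∷ [] }

  enumerates-++ : ∀ {P P₁ P₂ xs ys} → P U.≐ P₁ U.∪ P₂ → P₁ U.⊥ P₂ →
                  Enumerates P₁ xs → Enumerates P₂ ys → Enumerates P (xs ++ ys)
  enumerates-++ {xs = xs} (P⊆ , ⊆P) P₁⊥P₂ E₁ E₂ = record
    { sound    = All.++⁺ (All.map (⊆P ∘ inj₁) (sound E₁)) (All.map (⊆P ∘ inj₂) (sound E₂))
    ; complete = [ ∈-++⁺ˡ ∘ complete E₁ , ∈-++⁺ʳ xs ∘ complete E₂ ] ∘ P⊆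
    ; unique   = Unique.++⁺ (unique E₁) (unique E₂)
                   λ (x∈xs , x∈ys) → P₁⊥P₂ (All.lookup (sound E₁) x∈xs , All.lookup (sound E₂) x∈ys)
    }
    where open Enumerates

  ∈⇒1≤length : ∀ {x : A} {xs} → x ∈ₗ xs → 1 ≤ length xs
  ∈⇒1≤length {xs = _ ∷ _} _ = s≤s z≤n

  record PacedEnumeration (P : U.Pred A 0ℓ) (c b s : ℕ) (r : Transcript) : Set where
    field
      enumerates : Enumerates P (map proj₁ (proj₁ r))
      length≤    : length (proj₁ r) ≤ c
      paced      : Paced b s r

  pacedEnumeration-[] : ∀ {P c b s} → U.Empty P → PacedEnumeration P c b s ([] , b)
  pacedEnumeration-[] {s = s} empty = record
    { enumerates = enumerates-[] empty ; length≤ = z≤n ; paced = paced-[] {X = A} {s = s} }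

  pacedEnumeration-[_] : ∀ {P c b s} x → P x → (∀ {y} → P y → y ≡ x) → 1 ≤ c →
                         PacedEnumeration P c b s ((x , b) ∷ [] , b)
  pacedEnumeration-[ x ] Px only 1≤c = record
    { enumerates = enumerates-[ x ] Px only ; length≤ = 1≤c ; paced = paced-[ x ] }

  pacedEnumeration-⊕ : ∀ {P P₁ P₂ c₁ c₂ b s r₁ r₂} →
    P U.≐ P₁ U.∪ P₂ → P₁ U.⊥ P₂ → U.Satisfiable P →
    PacedEnumeration P₁ c₁ (suc b) s r₁ → PacedEnumeration P₂ c₂ (suc (proj₂ r₁)) s r₂ →
    PacedEnumeration P (c₁ + c₂) b (2 + s) (r₁ ⊕ r₂)
  pacedEnumeration-⊕ {P} {r₁ = L₁ , _} {r₂ = L₂ , _} P≐ P₁⊥P₂ (x , Px) E₁ E₂ = record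
    { enumerates = E
    ; length≤    = ≤-trans (≤-reflexive (length-++ L₁)) (+-mono-≤ (length≤ E₁) (length≤ E₂))
    ; paced      = paced-⊕ (L₁ , _) (L₂ , _) nonempty (paced E₁) (paced E₂)
    }
    where
    open PacedEnumeration
    E : Enumerates P (map proj₁ (L₁ ++ L₂))
    E = subst (Enumerates P) (≡.sym (map-++ proj₁ L₁ L₂))
          (enumerates-++ P≐ P₁⊥P₂ (enumerates E₁) (enumerates E₂))
    nonempty : 1 ≤ length L₁ + length L₂
    nonempty = ≤-trans (∈⇒1≤length (Enumerates.complete E Px))
                       (≤-reflexive (trans (length-map proj₁ (L₁ ++ L₂)) (length-++ L₁)))

infixr 5 _>>_
_>>_ : ∀ {n} → Proc n → Proc n → Proc n
done       >> k = k
query U f  >> k = query U (λ answer → f answer >> k)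
report e p >> k = report e (p >> k)

exec->> : ∀ {n} (p k : Proc n) o q → exec (p >> k) o q ≡ exec p o q ⊕ exec k o (proj₂ (exec p o q))
exec->> done       k o q = refl
exec->> (query U f) k o q = exec->> (f (o U)) k o (suc q)
exec->> (report e p) k o q = cong (λ r → (e , q) ∷ proj₁ r , proj₂ r) (exec->> p k o q)

edge⇒2≤n : ∀ {n} (G : Graph n) {a b} → Edge G a b → 2 ≤ n
edge⇒2≤n {suc zero}    G {zero} {zero} e with trans (≡.sym e) (irrefl G zero)
... | ()
edge⇒2≤n {suc (suc n)} G _ = s≤s (s≤s z≤n)

CrossEdge : ∀ {n} → Graph n → Subset n → Subset n → U.Pred (Fin n × Fin n) 0ℓ
CrossEdge G X Y (a , b) = a ∈ X × b ∈ Y × Edge G a b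

module _ {n} (G : Graph n) where

  crosses : Subset n → Subset n → Fin n → Fin n → Bool
  crosses X Y a b = Vec.lookup X a ∧ Vec.lookup Y b ∧ adj G a b

  crosses⇒CrossEdge : ∀ {X Y a b} → crosses X Y a b ≡ true → CrossEdge G X Y (a , b)
  crosses⇒CrossEdge {X} {Y} {a} {b} eq with Vec.lookup X a in a∈X | Vec.lookup Y b in b∈Y | eq
  ... | true  | true  | e  = lookup⇒[]= a X a∈X , lookup⇒[]= b Y b∈Y , e
  ... | true  | false | ()
  ... | false | _     | ()

  CrossEdge⇒crosses : ∀ {X Y a b} → CrossEdge G X Y (a , b) → crosses X Y a b ≡ true
  CrossEdge⇒crosses (a∈X , b∈Y , e) rewrite []=⇒lookup a∈X | []=⇒lookup b∈Y = e

  indepOracle≡false⇒edge : ∀ {U} → indepOracle G U ≡ false → U.Satisfiable (CrossEdge G U U)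
  indepOracle≡false⇒edge eq =
    let u , no-v = allF-false⁻ _ eq
        v , nuv  = allF-false⁻ _ no-v
    in (u , v) , crosses⇒CrossEdge (not-injective nuv)

  edge⇒indepOracle≡false : ∀ {U u v} → CrossEdge G U U (u , v) → indepOracle G U ≡ false
  edge⇒indepOracle≡false {u = u} {v} e = allF-false⁺ _ u (allF-false⁺ _ v (cong not (CrossEdge⇒crosses e)))

  independent-∩ : ∀ {X} V → Independent G X → Independent G (X ∩ V)
  independent-∩ {X} V indep u v u∈ v∈ = indep u v (p∩q⊆p X V u∈) (p∩q⊆p X V v∈)

  indepOracle-∪≡false : ∀ {X Y} → Independent G X → Independent G Y →
                        indepOracle G (X ∪ Y) ≡ false → U.Satisfiable (CrossEdge G X Y)
  indepOracle-∪≡false {X} {Y} indX indY eq with indepOracle≡false⇒edge eq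
  ... | (u , v) , u∈ , v∈ , e with x∈p∪q⁻ X Y u∈ | x∈p∪q⁻ X Y v∈
  ... | inj₁ u∈X | inj₁ v∈X = ⊥-elim (indX u v u∈X v∈X e)
  ... | inj₁ u∈X | inj₂ v∈Y = (u , v) , u∈X , v∈Y , e
  ... | inj₂ u∈Y | inj₁ v∈X = (v , u) , v∈X , u∈Y , trans (≡.sym (Graph.sym G u v)) e
  ... | inj₂ u∈Y | inj₂ v∈Y = ⊥-elim (indY u v u∈Y v∈Y e)

  indepOracle-∪≡true : ∀ {X Y} → indepOracle G (X ∪ Y) ≡ true → U.Empty (CrossEdge G X Y)
  indepOracle-∪≡true {X} {Y} eq (a , b) (a∈X , b∈Y , e)
    with trans (≡.sym eq) (edge⇒indepOracle≡false (p⊆p∪q Y a∈X , q⊆p∪q X Y b∈Y , e))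
  ... | ()

  private
    disjoint-lookup : ∀ {X₁ X₂ : Subset n} → Disjoint X₁ X₂ → ∀ a →
                      Vec.lookup X₁ a ≡ true → Vec.lookup X₂ a ≡ true → ⊥
    disjoint-lookup {X₁} {X₂} X₁∩X₂ a a∈X₁ a∈X₂ = X₁∩X₂ a (lookup⇒[]= a X₁ a∈X₁) (lookup⇒[]= a X₂ a∈X₂)

  crossEdges-∪ˡ : ∀ {X₁ X₂} Y → Disjoint X₁ X₂ →
                  crossEdges G (X₁ ∪ X₂) Y ≡ crossEdges G X₁ Y + crossEdges G X₂ Y
  crossEdges-∪ˡ {X₁} {X₂} Y X₁∩X₂ =
    trans (sumF-cong λ a → countF-+ (crosses X₁ Y a) (crosses X₂ Y a) _ (split a))
          (sumF-+ (countF ∘ crosses X₁ Y) (countF ∘ crosses X₂ Y))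
    where
    split : ∀ a b → indicator (crosses (X₁ ∪ X₂) Y a b)
                    ≡ indicator (crosses X₁ Y a b) + indicator (crosses X₂ Y a b)
    split a b rewrite lookup-zipWith _∨_ a X₁ X₂ =
      indicator-∨ true (Vec.lookup Y b ∧ adj G a b) (disjoint-lookup X₁∩X₂ a)

  crossEdges-∪ʳ : ∀ X {Y₁ Y₂} → Disjoint Y₁ Y₂ →
                  crossEdges G X (Y₁ ∪ Y₂) ≡ crossEdges G X Y₁ + crossEdges G X Y₂
  crossEdges-∪ʳ X {Y₁} {Y₂} Y₁∩Y₂ =
    trans (sumF-cong λ a → countF-+ (crosses X Y₁ a) (crosses X Y₂ a) _ (split a))
          (sumF-+ (countF ∘ crosses X Y₁) (countF ∘ crosses X Y₂))
    where
    split : ∀ a b → indicator (crosses X (Y₁ ∪ Y₂) a b)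
                    ≡ indicator (crosses X Y₁ a b) + indicator (crosses X Y₂ a b)
    split a b rewrite lookup-zipWith _∨_ b Y₁ Y₂ =
      indicator-∨ (Vec.lookup X a) (adj G a b) (disjoint-lookup Y₁∩Y₂ b)

  CrossEdge⇒1≤crossEdges : ∀ {X Y a b} → CrossEdge G X Y (a , b) → 1 ≤ crossEdges G X Y
  CrossEdge⇒1≤crossEdges {X} {Y} {a} {b} e = begin
    1                                  ≡⟨ cong indicator (≡.sym (CrossEdge⇒crosses e)) ⟩
    indicator (crosses X Y a b)        ≤⟨ term≤sumF (indicator ∘ crosses X Y a) b ⟩
    sumF (indicator ∘ crosses X Y a)   ≡⟨ ≡.sym (countF≡sumF (crosses X Y a)) ⟩
    countF (crosses X Y a)             ≤⟨ term≤sumF (countF ∘ crosses X Y) a ⟩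
    crossEdges G X Y                   ∎
    where open ≤-Reasoning

  CrossEdge-∪ˡ : ∀ {X₁ X₂} Y → CrossEdge G (X₁ ∪ X₂) Y U.≐ CrossEdge G X₁ Y U.∪ CrossEdge G X₂ Y
  CrossEdge-∪ˡ {X₁} {X₂} Y =
    (λ { {a , b} (a∈ , b∈ , e) → Sum.map (_, b∈ , e) (_, b∈ , e) (x∈p∪q⁻ X₁ X₂ a∈) }) ,
    λ { {a , b} (inj₁ (a∈ , rest)) → p⊆p∪q X₂ a∈ , rest
      ; {a , b} (inj₂ (a∈ , rest)) → q⊆p∪q X₁ X₂ a∈ , rest }

  CrossEdge-∪ʳ : ∀ X {Y₁ Y₂} → CrossEdge G X (Y₁ ∪ Y₂) U.≐ CrossEdge G X Y₁ U.∪ CrossEdge G X Y₂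
  CrossEdge-∪ʳ X {Y₁} {Y₂} =
    (λ { {a , b} (a∈ , b∈ , e) →
           Sum.map (λ b∈′ → a∈ , b∈′ , e) (λ b∈′ → a∈ , b∈′ , e) (x∈p∪q⁻ Y₁ Y₂ b∈) }) ,
    λ { {a , b} (inj₁ (a∈ , b∈ , e)) → a∈ , p⊆p∪q Y₂ b∈ , e
      ; {a , b} (inj₂ (a∈ , b∈ , e)) → a∈ , q⊆p∪q Y₁ Y₂ b∈ , e }

  CrossEdge-disjointˡ : ∀ {X₁ X₂} Y → Disjoint X₁ X₂ → CrossEdge G X₁ Y U.⊥ CrossEdge G X₂ Y
  CrossEdge-disjointˡ Y X₁∩X₂ {a , b} ((a∈X₁ , _) , (a∈X₂ , _)) = X₁∩X₂ a a∈X₁ a∈X₂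

  CrossEdge-disjointʳ : ∀ X {Y₁ Y₂} → Disjoint Y₁ Y₂ → CrossEdge G X Y₁ U.⊥ CrossEdge G X Y₂
  CrossEdge-disjointʳ X Y₁∩Y₂ {a , b} ((_ , b∈Y₁ , _) , (_ , b∈Y₂ , _)) = Y₁∩Y₂ b b∈Y₁ b∈Y₂

  CrossEnumeration : Subset n → Subset n → ℕ → ℕ → Transcript → Set
  CrossEnumeration X Y = PacedEnumeration (CrossEdge G X Y) (crossEdges G X Y)

  crossEnumeration-∪ˡ : ∀ {X X₁ X₂ Y b s r₁ r₂} → X ≡ X₁ ∪ X₂ → Disjoint X₁ X₂ →
    U.Satisfiable (CrossEdge G X Y) →
    CrossEnumeration X₁ Y (suc b) s r₁ → CrossEnumeration X₂ Y (suc (proj₂ r₁)) s r₂ →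
    CrossEnumeration X Y b (2 + s) (r₁ ⊕ r₂)
  crossEnumeration-∪ˡ {X₁ = X₁} {X₂} {Y} {b} {s} {r₁} {r₂} refl X₁∩X₂ sat E₁ E₂ =
    subst (λ c → PacedEnumeration (CrossEdge G (X₁ ∪ X₂) Y) c b (2 + s) (r₁ ⊕ r₂))
      (≡.sym (crossEdges-∪ˡ Y X₁∩X₂))
      (pacedEnumeration-⊕ (CrossEdge-∪ˡ Y) (CrossEdge-disjointˡ Y X₁∩X₂) sat E₁ E₂)

  crossEnumeration-∪ʳ : ∀ {X Y Y₁ Y₂ b s r₁ r₂} → Y ≡ Y₁ ∪ Y₂ → Disjoint Y₁ Y₂ →
    U.Satisfiable (CrossEdge G X Y) →
    CrossEnumeration X Y₁ (suc b) s r₁ → CrossEnumeration X Y₂ (suc (proj₂ r₁)) s r₂ →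
    CrossEnumeration X Y b (2 + s) (r₁ ⊕ r₂)
  crossEnumeration-∪ʳ {X} {Y₁ = Y₁} {Y₂} {b} {s} {r₁} {r₂} refl Y₁∩Y₂ sat E₁ E₂ =
    subst (λ c → PacedEnumeration (CrossEdge G X (Y₁ ∪ Y₂)) c b (2 + s) (r₁ ⊕ r₂))
      (≡.sym (crossEdges-∪ʳ X Y₁∩Y₂))
      (pacedEnumeration-⊕ (CrossEdge-∪ʳ X) (CrossEdge-disjointʳ X Y₁∩Y₂) sat E₁ E₂)

disjoint-∩ : ∀ {n} (X : Subset n) {V₁ V₂} → Disjoint V₁ V₂ → Disjoint (X ∩ V₁) (X ∩ V₂)
disjoint-∩ X {V₁} {V₂} V₁∩V₂ v v∈₁ v∈₂ = V₁∩V₂ v (p∩q⊆q X V₁ v∈₁) (p∩q⊆q X V₂ v∈₂)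

data Tree (A : Set) : ℕ → Set where
  empty : ∀ {d} → Tree A d
  leaf  : A → Tree A zero
  node  : ∀ {d} → Tree A d → Tree A d → Tree A (suc d)

vertices : ∀ {n d} → Tree (Fin n) d → Subset n
vertices empty      = ∅
vertices (leaf a)   = ⁅ a ⁆
vertices (node l r) = vertices l ∪ vertices r

DistinctLeaves : ∀ {n d} → Tree (Fin n) d → Set
DistinctLeaves empty      = ⊤
DistinctLeaves (leaf _)   = ⊤
DistinctLeaves (node l r) = DistinctLeaves l × DistinctLeaves r × Disjoint (vertices l) (vertices r)

balanced : ∀ {A} d → List A → Tree A d
balanced zero    []      = empty
balanced zero    (x ∷ _) = leaf x
balanced (suc d) xs      = node (balanced d (take (2 ^ d) xs)) (balanced d (drop (2 ^ d) xs))

module _ {A : Set} {v : A} where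

  ∈-take⇒∈ : ∀ k {xs} → v ∈ₗ take k xs → v ∈ₗ xs
  ∈-take⇒∈ k {xs} v∈ = subst (v ∈ₗ_) (take++drop≡id k xs) (∈-++⁺ˡ v∈)

  ∈-drop⇒∈ : ∀ k {xs} → v ∈ₗ drop k xs → v ∈ₗ xs
  ∈-drop⇒∈ k {xs} v∈ = subst (v ∈ₗ_) (take++drop≡id k xs) (∈-++⁺ʳ (take k xs) v∈)

  Unique-++⇒disjoint : ∀ xs {ys} → Unique (xs ++ ys) → v ∈ₗ xs → v ∈ₗ ys → ⊥
  Unique-++⇒disjoint (x ∷ xs) (x∉ ∷ _) (here refl) v∈ys = All.lookup x∉ (∈-++⁺ʳ xs v∈ys) refl
  Unique-++⇒disjoint (x ∷ xs) (_ ∷ u)  (there v∈xs) v∈ys = Unique-++⇒disjoint xs u v∈xs v∈ys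

vertices-balanced : ∀ {n} d {xs : List (Fin n)} {v} → v ∈ vertices (balanced d xs) → v ∈ₗ xs
vertices-balanced zero    {[]}    v∈ = ⊥-elim (∉⊥ v∈)
vertices-balanced zero    {x ∷ _} v∈ = here (x∈⁅y⁆⇒x≡y x v∈)
vertices-balanced (suc d) {xs}    v∈ =
  [ ∈-take⇒∈ (2 ^ d) ∘ vertices-balanced d , ∈-drop⇒∈ (2 ^ d) ∘ vertices-balanced d ] (x∈p∪q⁻ _ _ v∈)

∈-balanced : ∀ {n} d {xs : List (Fin n)} {v} → length xs ≤ 2 ^ d → v ∈ₗ xs → v ∈ vertices (balanced d xs)
∈-balanced zero    {x ∷ []}    _        (here refl) = x∈⁅x⁆ x
∈-balanced zero    {x ∷ _ ∷ _} (s≤s ()) _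
∈-balanced (suc d) {xs} {v}    len      v∈
  with ∈-++⁻ (take (2 ^ d) xs) (subst (v ∈ₗ_) (≡.sym (take++drop≡id (2 ^ d) xs)) v∈)
... | inj₁ v∈take = p⊆p∪q _ (∈-balanced d take≤ v∈take)
  where take≤ = ≤-trans (≤-reflexive (length-take (2 ^ d) xs)) (m⊓n≤m _ _)
... | inj₂ v∈drop = q⊆p∪q _ _ (∈-balanced d drop≤ v∈drop)
  where drop≤ = ≤-trans (≤-reflexive (length-drop (2 ^ d) xs))
                        (≤-trans (m≤n+o⇒m∸n≤o (length xs) (2 ^ d) len) (≤-reflexive (+-identityʳ _)))

balanced-distinct : ∀ {n} d {xs : List (Fin n)} → Unique xs → DistinctLeaves (balanced d xs)
balanced-distinct zero    {[]}    _ = tt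
balanced-distinct zero    {x ∷ _} _ = tt
balanced-distinct (suc d) {xs}    u =
  balanced-distinct d (Unique.take⁺ (2 ^ d) u) , balanced-distinct d (Unique.drop⁺ (2 ^ d) u) ,
  λ v v∈l v∈r → Unique-++⇒disjoint (take (2 ^ d) xs) (subst Unique (≡.sym (take++drop≡id (2 ^ d) xs)) u)
                  (vertices-balanced d v∈l) (vertices-balanced d v∈r)

module Enumeration {n} (A B : Subset n) where

  querySet : ∀ {d e} → Tree (Fin n) d → Tree (Fin n) e → Subset n
  querySet ta tb = A ∩ vertices ta ∪ B ∩ vertices tb

  enumerate refine : ∀ {d e} → Tree (Fin n) d → Tree (Fin n) e → Proc n
  enumerate ta tb = query (querySet ta tb) λ independent → if independent then done else refine ta tb
  refine empty      tb         = done
  refine (node l r) tb         = enumerate l tb >> enumerate r tb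
  refine (leaf a)   empty      = done
  refine (leaf a)   (leaf b)   = report (a , b) done
  refine (leaf a)   (node l r) = enumerate (leaf a) l >> enumerate (leaf a) r

module Correctness {n} (G : Graph n) {A B : Subset n} (indA : Independent G A) (indB : Independent G B) where
  open Enumeration A B

  enumerate-correct : ∀ {d e} (ta : Tree (Fin n) d) (tb : Tree (Fin n) e) q →
    DistinctLeaves ta → DistinctLeaves tb →
    CrossEnumeration G (A ∩ vertices ta) (B ∩ vertices tb) (suc q) ((d + e) * 2)
      (exec (enumerate ta tb) (indepOracle G) q)
  refine-correct : ∀ {d e} (ta : Tree (Fin n) d) (tb : Tree (Fin n) e) q →
    DistinctLeaves ta → DistinctLeaves tb → U.Satisfiable (CrossEdge G (A ∩ vertices ta) (B ∩ vertices tb)) →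
    CrossEnumeration G (A ∩ vertices ta) (B ∩ vertices tb) q ((d + e) * 2)
      (exec (refine ta tb) (indepOracle G) q)

  enumerate-correct ta tb q dta dtb with indepOracle G (querySet ta tb) in answer
  ... | true  = pacedEnumeration-[] (indepOracle-∪≡true G answer)
  ... | false = refine-correct ta tb (suc q) dta dtb
                  (indepOracle-∪≡false G (independent-∩ G _ indA) (independent-∩ G _ indB) answer)

  refine-correct empty tb q _ _ ((a , _) , a∈ , _) = ⊥-elim (∉⊥ (p∩q⊆q A ∅ a∈))
  refine-correct (node l r) tb q (dl , dr , l∩r) dtb sat
    rewrite exec->> (enumerate l tb) (enumerate r tb) (indepOracle G) q =
    crossEnumeration-∪ˡ G (∩-distribˡ-∪ A (vertices l) (vertices r)) (disjoint-∩ A l∩r) sat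
      (enumerate-correct l tb q dl dtb) (enumerate-correct r tb _ dr dtb)
  refine-correct (leaf a) empty q _ _ ((_ , b) , _ , b∈ , _) = ⊥-elim (∉⊥ (p∩q⊆q B ∅ b∈))
  refine-correct (leaf a) (leaf b) q _ _ (_ , e) =
    pacedEnumeration-[ a , b ] (subst (CrossEdge G _ _) (only e) e) only (CrossEdge⇒1≤crossEdges G e)
    where
    only : ∀ {p} → CrossEdge G (A ∩ ⁅ a ⁆) (B ∩ ⁅ b ⁆) p → p ≡ (a , b)
    only {a′ , b′} (a′∈ , b′∈ , _) = cong₂ _,_ (x∈⁅y⁆⇒x≡y a (p∩q⊆q A _ a′∈)) (x∈⁅y⁆⇒x≡y b (p∩q⊆q B _ b′∈))
  refine-correct (leaf a) (node l r) q _ (dl , dr , l∩r) sat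
    rewrite exec->> (enumerate (leaf a) l) (enumerate (leaf a) r) (indepOracle G) q =
    crossEnumeration-∪ʳ G (∩-distribˡ-∪ B (vertices l) (vertices r)) (disjoint-∩ B l∩r) sat
      (enumerate-correct (leaf a) l q _ dl) (enumerate-correct (leaf a) r _ _ dr)

n<2^[1+⌊log₂n⌋] : ∀ n → n < 2 ^ suc ⌊log₂ n ⌋
n<2^[1+⌊log₂n⌋] n = ≰⇒> λ 2^≤n →
  1+n≰n (subst (_≤ ⌊log₂ n ⌋) (⌊log₂[2^n]⌋≡n (suc ⌊log₂ n ⌋)) (⌊log₂⌋-mono-≤ 2^≤n))

2≤n⇒1≤⌊log₂n⌋ : ∀ {n} → 2 ≤ n → 1 ≤ ⌊log₂ n ⌋
2≤n⇒1≤⌊log₂n⌋ {n} 2≤n = subst (_≤ ⌊log₂ n ⌋) (⌊log₂[2^n]⌋≡n 1) (⌊log₂⌋-mono-≤ 2≤n)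

depth : ℕ → ℕ
depth n = suc ⌊log₂ n ⌋

vertexTree : ∀ n → Tree (Fin n) (depth n)
vertexTree n = balanced (depth n) (allFin n)

∈-vertexTree : ∀ {n} (v : Fin n) → v ∈ vertices (vertexTree n)
∈-vertexTree {n} v = ∈-balanced (depth n) n≤2^depth (∈-allFin v)
  where n≤2^depth = ≤-trans (≤-reflexive (length-tabulate id)) (<⇒≤ (n<2^[1+⌊log₂n⌋] n))

∩-vertexTree : ∀ {n} (X : Subset n) → X ∩ vertices (vertexTree n) ≡ X
∩-vertexTree X = ⊆-antisym (p∩q⊆p X _) (λ x∈X → x∈p∩q⁺ (x∈X , ∈-vertexTree _))

alg : (n : ℕ) → Subset n → Subset n → Proc n
alg n A B = Enumeration.enumerate A B (vertexTree n) (vertexTree n)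

alg-correct : ∀ {n} (G : Graph n) {A B} → Independent G A → Independent G B →
  CrossEnumeration G A B 1 ((depth n + depth n) * 2) (run (alg n A B) G)
alg-correct {n} G {A} {B} indA indB =
  subst₂ (λ X Y → CrossEnumeration G X Y 1 _ (run (alg n A B) G)) (∩-vertexTree A) (∩-vertexTree B)
    (enumerate-correct (vertexTree n) (vertexTree n) 0 distinct distinct)
  where open Correctness G indA indB
        distinct = balanced-distinct (depth n) (Unique.allFin⁺ n)

cost-bound : ∀ m L → (1 ≤ m → 1 ≤ L) → 1 + m * ((suc L + suc L) * 2) ≤ 8 * (1 + m * L)
cost-bound zero    L       _   = s≤s z≤n
cost-bound (suc m) zero    pos with pos (s≤s z≤n)
... | ()
cost-bound (suc m) (suc L) _   = ≤-trans (m≤m+n _ (7 + 4 * (suc m * L))) (≤-reflexive (eq m L))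
  where eq : ∀ m L → 1 + suc m * ((suc (suc L) + suc (suc L)) * 2) + (7 + 4 * (suc m * L))
                   ≡ 8 * (1 + suc m * suc L)
        eq = solve-∀

All-CrossEdge⇒2≤n : ∀ {n} (G : Graph n) {A B} {ps : List (Fin n × Fin n)} →
  All (CrossEdge G A B) ps → 1 ≤ length ps → 2 ≤ n
All-CrossEdge⇒2≤n G ((_ , _ , e) ∷ _) _ = edge⇒2≤n G e

lemmaA2 : Σ ℕ λ c → Σ ((n : ℕ) → Subset n → Subset n → Proc n) λ alg →
    ∀ (n : ℕ) (G : Graph n) (A B : Subset n) →
    Disjoint A B → Independent G A → Independent G B →
      (∀ a b → (a , b) ∈ₗ map proj₁ (proj₁ (run (alg n A B) G)) →
         a ∈ A × b ∈ B × Edge G a b)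
      × (∀ a b → a ∈ A → b ∈ B → Edge G a b →
           (a , b) ∈ₗ map proj₁ (proj₁ (run (alg n A B) G)))
      × Unique (map proj₁ (proj₁ (run (alg n A B) G)))
      × (∀ (i : Fin (length (proj₁ (run (alg n A B) G)))) →
           proj₂ (lookup (proj₁ (run (alg n A B) G)) i)
             ≤ c * (1 + suc (toℕ i) * ⌊log₂ n ⌋))
      × proj₂ (run (alg n A B) G) ≤ c * (1 + crossEdges G A B * ⌊log₂ n ⌋)
lemmaA2 = 8 , alg , λ n G A B _ indA indB →
  let open PacedEnumeration (alg-correct G indA indB)
      open Enumerates enumerates
      L = proj₁ (run (alg n A B) G)
      log-positive : 1 ≤ length L → 1 ≤ ⌊log₂ n ⌋
      log-positive nonempty = 2≤n⇒1≤⌊log₂n⌋ (All-CrossEdge⇒2≤n G sound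
                                (≤-trans nonempty (≤-reflexive (≡.sym (length-map proj₁ L)))))
  in  (λ _ _ → All.lookup sound) ,
      (λ _ _ a∈A b∈B e → complete (a∈A , b∈B , e)) ,
      unique ,
      (λ i → ≤-trans (onSchedule-lookup L (proj₁ paced) i)
                     (cost-bound (suc (toℕ i)) _ λ _ → log-positive (≤-trans (s≤s z≤n) (toℕ<n i)))) ,
      ≤-trans (proj₂ paced)
        (≤-trans (cost-bound (length L) _ log-positive)
                 (*-monoʳ-≤ 8 (+-monoʳ-≤ 1 (*-monoˡ-≤ ⌊log₂ n ⌋ length≤))))
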